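{- Let $k\in\mathbb{N}$ be fixed and let $\mathcal{H}$ be a hypergraph on vertex set $V$ with $\textsc{VC-dim}(\mathcal{H})<k$. Then $|\mathrm{ext}_k(\mathcal{H})|=O(|V|^k)$.
   Context: A hypergraph $\mathcal{H}$ on $V$ is a family of subsets of the finite set $V$. A $k$-trace on $V$ is a pair $(T,S)$ with $T\subseteq S\subseteq V$ and $|S|=k$; a set $F\subseteq V$ realizes $(T,S)$ if $F\cap S=T$. $\mathrm{traces}_k(F)$ is the set of $k$-traces on $V$ realized by $F$, and $\mathrm{traces}_k(\mathcal{H})=\bigcup_{F\in\mathcal{H}}\mathrm{traces}_k(F)$. A set $E\subseteq V$ is $k$-compatible with $\mathcal{H}$ if $\mathrm{traces}_k(E)\subseteq\mathrm{traces}_k(\mathcal{H})$; the $k$-extension $\mathrm{ext}_k(\mathcal{H})$ is the hypergraph on $V$ whose hyperedges are all subsets of $V$ that are $k$-compatible with $\mathcal{H}$. A set $U$ is shattered by $\mathcal{H}$ if $\{F\cap U: F\in\mathcal{H}\}=2^U$; $\textsc{VC-dim}(\mathcal{H})$ is the maximum size of a shattered set. -}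

module Defs where

open import Data.Nat using (ℕ; _<_)
open import Data.Fin.Subset using (Subset; _∩_; _⊆_; ∣_∣)
open import Data.Product using (Σ; _×_; ∃-syntax)
open import Relation.Binary.PropositionalEquality using (_≡_)

-- The vertex set V is Fin n; a subset of V is a `Subset n`.
-- A hypergraph on V is a family (set) of subsets of V, given by its
-- membership predicate.
Hypergraph : ℕ → Set₁
Hypergraph n = Subset n → Set

Realizes : ∀ {n} → Subset n → Subset n → Subset n → Set
Realizes F T S = F ∩ S ≡ T

InTracesH : ∀ {n} → ℕ → Hypergraph n → Subset n → Subset n → Set
InTracesH k H T S = (T ⊆ S) × (∣ S ∣ ≡ k) × (∃[ F ] (H F × Realizes F T S))

InTracesOf : ∀ {n} → ℕ → Subset n → Subset n → Subset n → Set
InTracesOf k F T S = (T ⊆ S) × (∣ S ∣ ≡ k) × Realizes F T S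

KCompatible : ∀ {n} → ℕ → Hypergraph n → Subset n → Set
KCompatible {n} k H E =
  ∀ (T S : Subset n) → InTracesOf k E T S → InTracesH k H T S

Ext : ∀ {n} → ℕ → Hypergraph n → Hypergraph n
Ext k H E = KCompatible k H E

Shattered : ∀ {n} → Hypergraph n → Subset n → Set
Shattered H U = ∀ T → T ⊆ U → ∃[ F ] (H F × F ∩ U ≡ T)

VCdimLessThan : ∀ {n} → Hypergraph n → ℕ → Set
VCdimLessThan H k = ∀ U → Shattered H U → ∣ U ∣ < k

{-# OPTIONS --safe #-}

-- Let S be a k-set shattered by ext_k(H). A member E of ext_k(H) with E ∩ S = T
-- realizes the k-trace (T , S), which must therefore be realized by H, so H
-- shatters S too. Shattering is hereditary, hence VC-dim(ext_k(H)) < k as well,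
-- and the Sauer–Shelah lemma bounds a family of VC-dimension < k on n points by
-- Σ_{i<k} C(n,i) ≤ (n+1)^k ≤ 2^k n^k. Sauer–Shelah is proved by deleting a point
-- v: a family splits into its projection onto V ∖ {v}, of VC-dimension < k, and
-- the sets F with both F and F ∪ {v} in the family, of VC-dimension < k - 1.

module Submission where

open import Defs
open import Data.Nat using (ℕ; _≤_; _*_; _^_)
open import Data.Fin.Subset using (Subset)
open import Data.List using (List; length)
open import Data.List.Relation.Unary.All using (All)
open import Data.List.Relation.Unary.Unique.Propositional using (Unique)
open import Data.Product using (∃-syntax)

open import Data.Bool as Bool using (Bool; true; false)
open import Data.Fin.Subset using (_∩_; _⊆_; ∣_∣; ⊥)
open import Data.Fin.Subset.Properties
  using (drop-∷-⊆; out⊆; in⊆in; ⊥⊆; ∣⊥∣≡0; ⊆-trans; ⊆-antisym; p∩q⊆p; x∈p∩q⁺; ∩-comm; ∩-assoc; ∩-zeroʳ)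
open import Data.List using ([]; _∷_; _++_; filter)
open import Data.List.Properties using (length-++)
open import Data.List.Membership.Propositional using (_∈_)
open import Data.List.Membership.Propositional.Properties using (∈-++⁻; ∈-filter⁻)
import Data.List.Membership.DecPropositional as DecMembership
open import Data.List.Relation.Unary.All as All using ([]; _∷_)
open import Data.List.Relation.Unary.AllPairs using ([]; _∷_)
open import Data.List.Relation.Unary.Any using (here; there)
import Data.List.Relation.Unary.Unique.Propositional.Properties as Unique
open import Data.Nat using (zero; suc; _+_; z≤n; s≤s⁻¹)
open import Data.Nat.Properties
  using (_≤?_; ≰⇒>; <⇒≢; n≮0; ≤-refl; ≤-reflexive; n≤1+n; +-suc; +-assoc; +-comm; +-identityʳ;
         +-mono-≤; +-monoˡ-≤; *-monoʳ-≤; ^-zeroˡ; ^-monoˡ-≤; *-commutativeSemigroup; module ≤-Reasoning)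
open import Algebra.Properties.CommutativeSemigroup *-commutativeSemigroup using (interchange)
open import Data.Product as Product using (_×_; _,_)
open import Data.Sum as Sum using (_⊎_; inj₁; inj₂)
open import Data.Vec as Vec using ([]; _∷_)
open import Data.Vec.Properties using (≡-dec)
open import Function using (_∘_)
open import Relation.Binary.Definitions using (DecidableEquality)
open import Relation.Binary.PropositionalEquality using (_≡_; refl; sym; trans; cong; module ≡-Reasoning)
open import Relation.Nullary using (Dec; yes; no; contradiction)
open import Relation.Unary.Properties using (∁?)

p⊆q⇒p∩q≡p : ∀ {n} {p q : Subset n} → p ⊆ q → p ∩ q ≡ p
p⊆q⇒p∩q≡p {p = p} {q} p⊆q = ⊆-antisym (p∩q⊆p p q) (λ x∈p → x∈p∩q⁺ (x∈p , p⊆q x∈p))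

subset-of-size : ∀ {n} k (U : Subset n) → k ≤ ∣ U ∣ → ∃[ S ] (S ⊆ U × ∣ S ∣ ≡ k)
subset-of-size {n} zero U _ = ⊥ , ⊥⊆ , ∣⊥∣≡0 n
subset-of-size k (false ∷ U) k≤∣U∣ with subset-of-size k U k≤∣U∣
... | S , S⊆U , ∣S∣≡k = false ∷ S , out⊆ S⊆U , ∣S∣≡k
subset-of-size (suc k) (true ∷ U) k<∣U∣ with subset-of-size k U (s≤s⁻¹ k<∣U∣)
... | S , S⊆U , ∣S∣≡k = true ∷ S , in⊆in S⊆U , cong suc ∣S∣≡k

module _ {n : ℕ} where

  shattered-mono : {H H′ : Hypergraph n} {U : Subset n} →
                   (∀ {F} → H F → H′ F) → Shattered H U → Shattered H′ U
  shattered-mono H⊆H′ shU T T⊆U with shU T T⊆U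
  ... | F , HF , F∩U≡T = F , H⊆H′ HF , F∩U≡T

  shattered-⊆ : {H : Hypergraph n} {S U : Subset n} → S ⊆ U → Shattered H U → Shattered H S
  shattered-⊆ {S = S} {U} S⊆U shU T T⊆S with shU T (⊆-trans T⊆S S⊆U)
  ... | F , HF , F∩U≡T = F , HF , F∩S≡T
    where
    open ≡-Reasoning
    F∩S≡T : F ∩ S ≡ T
    F∩S≡T = begin
      F ∩ S        ≡⟨ cong (F ∩_) (sym (trans (∩-comm U S) (p⊆q⇒p∩q≡p S⊆U))) ⟩
      F ∩ (U ∩ S)  ≡⟨ sym (∩-assoc F U S) ⟩
      (F ∩ U) ∩ S  ≡⟨ cong (_∩ S) F∩U≡T ⟩
      T ∩ S        ≡⟨ p⊆q⇒p∩q≡p T⊆S ⟩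
      T            ∎

  ⊥-shattered : {H : Hypergraph n} {F : Subset n} → H F → Shattered H ⊥
  ⊥-shattered {F = F} HF T T⊆⊥ = F , HF , trans (∩-zeroʳ F) (⊆-antisym ⊥⊆ T⊆⊥)

  vcdim<-subfamily : ∀ {H H′ : Hypergraph n} {k} →
                     (∀ {F} → H F → H′ F) → VCdimLessThan H′ k → VCdimLessThan H k
  vcdim<-subfamily H⊆H′ vc U shU = vc U (shattered-mono H⊆H′ shU)

  ext-shatters⇒shatters : ∀ {k} {H : Hypergraph n} {S : Subset n} →
                          ∣ S ∣ ≡ k → Shattered (Ext k H) S → Shattered H S
  ext-shatters⇒shatters ∣S∣≡k shS T T⊆S with shS T T⊆S
  ... | E , compatible , E∩S≡T with compatible T _ (T⊆S , ∣S∣≡k , E∩S≡T)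
  ...   | _ , _ , F , HF , F∩S≡T = F , HF , F∩S≡T

  vcdim<-ext : ∀ {k} {H : Hypergraph n} → VCdimLessThan H k → VCdimLessThan (Ext k H) k
  vcdim<-ext {k} vc U shU with k ≤? ∣ U ∣
  ... | no k≰∣U∣ = ≰⇒> k≰∣U∣
  ... | yes k≤∣U∣ with subset-of-size k U k≤∣U∣
  ...   | S , S⊆U , ∣S∣≡k =
    contradiction ∣S∣≡k (<⇒≢ (vc S (ext-shatters⇒shatters ∣S∣≡k (shattered-⊆ S⊆U shU))))

module _ {n : ℕ} where

  Projection : Hypergraph (suc n) → Hypergraph n
  Projection H F = H (false ∷ F) ⊎ H (true ∷ F)

  Twins : Hypergraph (suc n) → Hypergraph n
  Twins H F = H (false ∷ F) × H (true ∷ F)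

  shattered-projection : ∀ {H W} → Shattered (Projection H) W → Shattered H (false ∷ W)
  shattered-projection sh (true ∷ T) T⊆ = contradiction (T⊆ Vec.here) λ ()
  shattered-projection sh (false ∷ T) T⊆ with sh T (drop-∷-⊆ T⊆)
  ... | F , inj₁ H[0F] , F∩W≡T = false ∷ F , H[0F] , cong (false ∷_) F∩W≡T
  ... | F , inj₂ H[1F] , F∩W≡T = true ∷ F , H[1F] , cong (false ∷_) F∩W≡T

  shattered-twins : ∀ {H W} → Shattered (Twins H) W → Shattered H (true ∷ W)
  shattered-twins sh (b ∷ T) T⊆ with sh T (drop-∷-⊆ T⊆)
  shattered-twins sh (false ∷ T) T⊆ | F , (H[0F] , _) , F∩W≡T = false ∷ F , H[0F] , cong (false ∷_) F∩W≡T
  shattered-twins sh (true ∷ T) T⊆ | F , (_ , H[1F]) , F∩W≡T = true ∷ F , H[1F] , cong (true ∷_) F∩W≡T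

  vcdim<-projection : ∀ {H k} → VCdimLessThan H k → VCdimLessThan (Projection H) k
  vcdim<-projection vc W sh = vc (false ∷ W) (shattered-projection sh)

  vcdim<-twins : ∀ {H k} → VCdimLessThan H (suc k) → VCdimLessThan (Twins H) k
  vcdim<-twins vc W sh = s≤s⁻¹ (vc (true ∷ W) (shattered-twins sh))

module _ {A : Set} {P : A → Set} (P? : ∀ x → Dec (P x)) where

  length-filter+filter-∁ : ∀ xs → length (filter P? xs) + length (filter (∁? P?) xs) ≡ length xs
  length-filter+filter-∁ [] = refl
  length-filter+filter-∁ (x ∷ xs) with P? x
  ... | yes _ = cong suc (length-filter+filter-∁ xs)
  ... | no _ = trans (+-suc _ _) (cong suc (length-filter+filter-∁ xs))

module _ {A : Set} (_≟_ : DecidableEquality A) where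

  open DecMembership _≟_ using (_∈?_; _∉?_)

  union : List A → List A → List A
  union xs ys = xs ++ filter (_∉? xs) ys

  intersection : List A → List A → List A
  intersection xs ys = filter (_∈? xs) ys

  ∈-union⁻ : ∀ {z} xs ys → z ∈ union xs ys → z ∈ xs ⊎ z ∈ ys
  ∈-union⁻ xs ys z∈ = Sum.map₂ (λ z∈ys∖xs → Product.proj₁ (∈-filter⁻ (_∉? xs) z∈ys∖xs)) (∈-++⁻ xs z∈)

  ∈-intersection⁻ : ∀ {z} xs ys → z ∈ intersection xs ys → z ∈ xs × z ∈ ys
  ∈-intersection⁻ xs ys z∈ = Product.swap (∈-filter⁻ (_∈? xs) z∈)

  union-unique : ∀ {xs ys} → Unique xs → Unique ys → Unique (union xs ys)
  union-unique {xs} {ys} uxs uys = Unique.++⁺ uxs (Unique.filter⁺ (_∉? xs) uys)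
    λ (z∈xs , z∈ys∖xs) → Product.proj₂ (∈-filter⁻ (_∉? xs) {xs = ys} z∈ys∖xs) z∈xs

  intersection-unique : ∀ {xs ys} → Unique ys → Unique (intersection xs ys)
  intersection-unique {xs} = Unique.filter⁺ (_∈? xs)

  length-union+intersection : ∀ xs ys →
    length (union xs ys) + length (intersection xs ys) ≡ length xs + length ys
  length-union+intersection xs ys = begin
    length (xs ++ ys∖xs) + length ys∩xs       ≡⟨ cong (_+ length ys∩xs) (length-++ xs) ⟩
    length xs + length ys∖xs + length ys∩xs   ≡⟨ +-assoc (length xs) _ _ ⟩
    length xs + (length ys∖xs + length ys∩xs) ≡⟨ cong (length xs +_) (+-comm (length ys∖xs) _) ⟩
    length xs + (length ys∩xs + length ys∖xs) ≡⟨ cong (length xs +_) (length-filter+filter-∁ (_∈? xs) ys) ⟩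
    length xs + length ys                     ∎
    where
    open ≡-Reasoning
    ys∖xs ys∩xs : List A
    ys∖xs = filter (_∉? xs) ys
    ys∩xs = filter (_∈? xs) ys

module _ {n : ℕ} where

  slice : Bool → List (Subset (suc n)) → List (Subset n)
  slice b [] = []
  slice b ((c ∷ F) ∷ L) with b Bool.≟ c
  ... | yes _ = F ∷ slice b L
  ... | no _ = slice b L

  ∈-slice⁻ : ∀ {b F} L → F ∈ slice b L → (b ∷ F) ∈ L
  ∈-slice⁻ {b} ((c ∷ G) ∷ L) F∈ with b Bool.≟ c | F∈
  ... | yes refl | here refl = here refl
  ... | yes refl | there F∈′ = there (∈-slice⁻ L F∈′)
  ... | no _ | F∈′ = there (∈-slice⁻ L F∈′)

  All-slice : ∀ {P : Subset (suc n) → Set} {b L} → All P L → All (λ F → P (b ∷ F)) (slice b L)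
  All-slice [] = []
  All-slice {b = b} {L = (c ∷ F) ∷ L} (PcF ∷ PL) with b Bool.≟ c
  ... | yes refl = PcF ∷ All-slice PL
  ... | no _ = All-slice PL

  slice-unique : ∀ {b L} → Unique L → Unique (slice b L)
  slice-unique [] = []
  slice-unique {b} {(c ∷ F) ∷ L} (distinct ∷ uL) with b Bool.≟ c
  ... | yes refl = All.map (λ bF≢ F≡ → bF≢ (cong (b ∷_) F≡)) (All-slice distinct) ∷ slice-unique uL
  ... | no _ = slice-unique uL

  length-slices : ∀ L → length L ≡ length (slice false L) + length (slice true L)
  length-slices [] = refl
  length-slices ((false ∷ F) ∷ L) = cong suc (length-slices L)
  length-slices ((true ∷ F) ∷ L) = trans (cong suc (length-slices L)) (sym (+-suc _ _))

-- sauerBound n k = Σ_{i<k} C(n,i), computed by Pascal's rule.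
sauerBound : ℕ → ℕ → ℕ
sauerBound _ zero = 0
sauerBound zero (suc k) = 1
sauerBound (suc n) (suc k) = sauerBound n (suc k) + sauerBound n k

sauer-shelah : ∀ {n} k (L : List (Subset n)) → Unique L → VCdimLessThan (_∈ L) k →
               length L ≤ sauerBound n k
sauer-shelah zero [] _ _ = z≤n
sauer-shelah zero (F ∷ _) _ vc = contradiction (vc ⊥ (⊥-shattered (here refl))) n≮0
sauer-shelah {zero} (suc k) [] _ _ = z≤n
sauer-shelah {zero} (suc k) ([] ∷ []) _ _ = ≤-refl
sauer-shelah {zero} (suc k) ([] ∷ [] ∷ _) ((≢ ∷ _) ∷ _) _ = contradiction refl ≢
sauer-shelah {suc n} (suc k) L uL vc = begin
  length L                                       ≡⟨ length-slices L ⟩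
  length L₀ + length L₁                          ≡⟨ length-union+intersection _≟_ L₀ L₁ ⟨
  length (union _≟_ L₀ L₁) + length (intersection _≟_ L₀ L₁)
    ≤⟨ +-mono-≤ (sauer-shelah (suc k) _ (union-unique _≟_ uL₀ uL₁) vc∪)
                (sauer-shelah k _ (intersection-unique _≟_ uL₁) vc∩) ⟩
  sauerBound n (suc k) + sauerBound n k          ∎
  where
  open ≤-Reasoning
  _≟_ : DecidableEquality (Subset n)
  _≟_ = ≡-dec Bool._≟_
  L₀ L₁ : List (Subset n)
  L₀ = slice false L
  L₁ = slice true L
  uL₀ : Unique L₀
  uL₀ = slice-unique uL
  uL₁ : Unique L₁
  uL₁ = slice-unique uL
  vc∪ : VCdimLessThan (_∈ union _≟_ L₀ L₁) (suc k)
  vc∪ = vcdim<-subfamily (Sum.map (∈-slice⁻ L) (∈-slice⁻ L) ∘ ∈-union⁻ _≟_ L₀ L₁) (vcdim<-projection vc)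
  vc∩ : VCdimLessThan (_∈ intersection _≟_ L₀ L₁) k
  vc∩ = vcdim<-subfamily (Product.map (∈-slice⁻ L) (∈-slice⁻ L) ∘ ∈-intersection⁻ _≟_ L₀ L₁) (vcdim<-twins vc)

sauerBound≤[1+n]^k : ∀ n k → sauerBound n k ≤ suc n ^ k
sauerBound≤[1+n]^k n zero = z≤n
sauerBound≤[1+n]^k zero (suc k) = ≤-reflexive (sym (^-zeroˡ (suc k)))
sauerBound≤[1+n]^k (suc n) (suc k) = begin
  sauerBound n (suc k) + sauerBound n k  ≤⟨ +-mono-≤ (sauerBound≤[1+n]^k n (suc k)) (sauerBound≤[1+n]^k n k) ⟩
  suc n * suc n ^ k + suc n ^ k          ≡⟨ +-comm (suc n * suc n ^ k) _ ⟩
  suc (suc n) * suc n ^ k                ≤⟨ *-monoʳ-≤ (suc (suc n)) (^-monoˡ-≤ k (n≤1+n (suc n))) ⟩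
  suc (suc n) ^ suc k                    ∎
  where open ≤-Reasoning

^-distribʳ-* : ∀ m n k → (m * n) ^ k ≡ m ^ k * n ^ k
^-distribʳ-* m n zero = refl
^-distribʳ-* m n (suc k) = begin
  m * n * (m * n) ^ k        ≡⟨ cong (m * n *_) (^-distribʳ-* m n k) ⟩
  m * n * (m ^ k * n ^ k)    ≡⟨ interchange m n (m ^ k) (n ^ k) ⟩
  m * m ^ k * (n * n ^ k)    ∎
  where open ≡-Reasoning

[1+n]^k≤2^k*n^k : ∀ {n} k → 1 ≤ n → suc n ^ k ≤ 2 ^ k * n ^ k
[1+n]^k≤2^k*n^k {n} k 1≤n = begin
  suc n ^ k    ≤⟨ ^-monoˡ-≤ k (+-monoˡ-≤ n 1≤n) ⟩
  (n + n) ^ k  ≡⟨ cong (λ m → (n + m) ^ k) (+-identityʳ n) ⟨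
  (2 * n) ^ k  ≡⟨ ^-distribʳ-* 2 n k ⟩
  2 ^ k * n ^ k ∎
  where open ≤-Reasoning

corollary2 : (k : ℕ) → ∃[ C ] ∃[ N ] ((n : ℕ) → N ≤ n →
    (H : Hypergraph n) → VCdimLessThan H k →
    (L : List (Subset n)) → Unique L → All (Ext k H) L →
    length L ≤ C * n ^ k)
corollary2 k = 2 ^ k , 1 , λ n 1≤n H vc L uL L⊆ext → begin
  length L        ≤⟨ sauer-shelah k L uL (vcdim<-subfamily (All.lookup L⊆ext) (vcdim<-ext vc)) ⟩
  sauerBound n k  ≤⟨ sauerBound≤[1+n]^k n k ⟩
  suc n ^ k       ≤⟨ [1+n]^k≤2^k*n^k k 1≤n ⟩
  2 ^ k * n ^ k   ∎
  where open ≤-Reasoning
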